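{- There exists a binary, resolvable incomplete-block design with $36$ points and $42$ blocks, each block of size $6$ and each point in exactly $7$ blocks, in which every pair of distinct points occurs together in $0$, $1$ or $2$ blocks, and each of the values $0$, $1$, $2$ occurs as the number of blocks containing some pair of distinct points.
   Context: A block design is binary if no block contains a point more than once. It is resolvable if its blocks can be partitioned into classes (replicates) each of which partitions the point set. The concurrence of two distinct points is the number of blocks containing both. -}

module Defs where

open import Level using (0ℓ)
open import Data.Nat using (ℕ; _≤_)
open import Data.Fin using (Fin)
open import Data.Fin.Properties using (_≟_)
open import Data.Vec using (Vec; lookup)
open import Data.Vec.Membership.Propositional using (_∈_)
open import Data.Vec.Membership.DecPropositional (_≟_ {36}) using (_∈?_)
open import Data.List using (length; filter; allFin)
open import Data.Product using (Σ; _×_)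
open import Relation.Unary using (Pred; Decidable)
open import Relation.Nullary.Decidable using (_×-dec_)
open import Relation.Binary.PropositionalEquality using (_≡_)

count : ∀ {n} {P : Pred (Fin n) 0ℓ} → Decidable P → ℕ
count {n} P? = length (filter P? (allFin n))

-- Point multiplicity within a block is allowed
-- by this representation; binarity is a separate property.
Design : ℕ → ℕ → Set
Design b k = Fin b → Vec (Fin 36) k

Binary : ∀ {b k} → Design b k → Set
Binary {b} {k} D = ∀ (j : Fin b) (x y : Fin k) → lookup (D j) x ≡ lookup (D j) y → x ≡ y

replication : ∀ {b k} → Design b k → Fin 36 → ℕ
replication D p = count (λ j → p ∈? D j)

concurrence : ∀ {b k} → Design b k → Fin 36 → Fin 36 → ℕ
concurrence D p q = count (λ j → (p ∈? D j) ×-dec (q ∈? D j))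

Resolvable : ∀ {b k} → Design b k → Set
Resolvable {b} D =
  Σ ℕ λ r → Σ (Fin b → Fin r) λ cls →
    ∀ (c : Fin r) (p : Fin 36) → count (λ j → (cls j ≟ c) ×-dec (p ∈? D j)) ≡ 1

-- The points are the cells of a 6 × 6 grid.  The seven parallel classes are the
-- rows (twice), the columns (twice), the lines c ≡ i + r and c ≡ i − r modulo 6,
-- and six disjoint transversals.  Two cells in a common row or column meet in
-- exactly the two copies of that line.  Any other two cells share at most one
-- line of slope ±1, unless they differ by (3, 3), when they share both; the
-- transversals contain no such pair, so no concurrence exceeds 2.
module Submission where

open import Defs
open import Data.Nat using (ℕ; _*_; _+_; _≤_; _≤?_)
import Data.Nat.Properties as ℕ
open import Data.Nat.DivMod using (_mod_)
open import Data.Fin using (Fin; #_; toℕ; combine; quotient; remQuot)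
open import Data.Fin.Properties using (_≟_; all?)
open import Data.Vec using (Vec; _∷_; []; lookup; tabulate)
open import Data.Vec.Membership.DecPropositional (_≟_ {36}) using (_∈?_)
open import Data.Product using (Σ; _×_; _,_)
open import Relation.Nullary using (¬_; Dec)
open import Relation.Nullary.Decidable using (from-yes; ¬?; _×-dec_; _→-dec_)
open import Relation.Binary.PropositionalEquality using (_≡_; refl)

IsResolution : ∀ {b k r} → Design b k → (Fin b → Fin r) → Set
IsResolution D cls = ∀ c p → count (λ j → (cls j ≟ c) ×-dec (p ∈? D j)) ≡ 1

binary? : ∀ {b k} (D : Design b k) → Dec (Binary D)
binary? D = all? λ j → all? λ x → all? λ y →
  (lookup (D j) x ≟ lookup (D j) y) →-dec (x ≟ y)

isResolution? : ∀ {b k r} (D : Design b k) (cls : Fin b → Fin r) →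
                Dec (IsResolution D cls)
isResolution? D cls = all? λ c → all? λ p →
  count (λ j → (cls j ≟ c) ×-dec (p ∈? D j)) ℕ.≟ 1

replication≡? : ∀ {b k} (D : Design b k) (r : ℕ) → Dec (∀ p → replication D p ≡ r)
replication≡? D r = all? λ p → replication D p ℕ.≟ r

concurrence≤? : ∀ {b k} (D : Design b k) (λ₀ : ℕ) →
                Dec (∀ p q → ¬ (p ≡ q) → concurrence D p q ≤ λ₀)
concurrence≤? D λ₀ = all? λ p → all? λ q → ¬? (p ≟ q) →-dec (concurrence D p q ≤? λ₀)

-- Cell (r, c) of the grid is the point 6r + c.
cell : Fin 6 → Fin 6 → Fin 36
cell = combine

ParallelClass : Set
ParallelClass = Fin 6 → Fin 6 → Fin 36

rows columns : ParallelClass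
rows i c = cell i c
columns i r = cell r i

lines : ℕ → ParallelClass
lines s i r = cell r ((toℕ i + s * toℕ r) mod 6)

transversals : Vec (Vec (Fin 6) 6) 6 → ParallelClass
transversals σ i r = cell r (lookup (lookup σ i) r)

seventhClass : ParallelClass
seventhClass = transversals
  ( (# 1 ∷ # 2 ∷ # 5 ∷ # 3 ∷ # 0 ∷ # 4 ∷ [])
  ∷ (# 5 ∷ # 0 ∷ # 1 ∷ # 4 ∷ # 2 ∷ # 3 ∷ [])
  ∷ (# 0 ∷ # 3 ∷ # 2 ∷ # 5 ∷ # 4 ∷ # 1 ∷ [])
  ∷ (# 3 ∷ # 5 ∷ # 4 ∷ # 2 ∷ # 1 ∷ # 0 ∷ [])
  ∷ (# 2 ∷ # 4 ∷ # 0 ∷ # 1 ∷ # 3 ∷ # 5 ∷ [])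
  ∷ (# 4 ∷ # 1 ∷ # 3 ∷ # 0 ∷ # 5 ∷ # 2 ∷ [])
  ∷ [])

classes : Vec ParallelClass 7
classes = rows ∷ rows ∷ columns ∷ columns ∷ lines 1 ∷ lines 5 ∷ seventhClass ∷ []

design : Design 42 6
design j with remQuot 6 j
... | c , i = tabulate (lookup classes c i)

classOf : Fin 42 → Fin 7
classOf = quotient 6

mainTheorem3 : Σ (Design 42 6) λ D →
    Binary D × Resolvable D
    × (∀ p → replication D p ≡ 7)
    × (∀ p q → ¬ (p ≡ q) → concurrence D p q ≤ 2)
    × (Σ (Fin 36) λ p → Σ (Fin 36) λ q → ¬ (p ≡ q) × concurrence D p q ≡ 0)
    × (Σ (Fin 36) λ p → Σ (Fin 36) λ q → ¬ (p ≡ q) × concurrence D p q ≡ 1)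
    × (Σ (Fin 36) λ p → Σ (Fin 36) λ q → ¬ (p ≡ q) × concurrence D p q ≡ 2)
mainTheorem3 = design
  , from-yes (binary? design)
  , (7 , classOf , from-yes (isResolution? design classOf))
  , from-yes (replication≡? design 7)
  , from-yes (concurrence≤? design 2)
  , (# 0 , # 8 , (λ ()) , refl)
  , (# 0 , # 7 , (λ ()) , refl)
  , (# 0 , # 1 , (λ ()) , refl)
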